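{- Let $q\in\mathbb{C}$ with $0<|q|<1$ and $a,b\in\mathbb{C}$. Let $B_{n,k}(a,b)$ ($n\ge k\ge0$) be the unique complex numbers such that for every integer $k\ge0$, $$z^k=\sum_{n=k}^\infty B_{n,k}(a,b)\,z^n\frac{(az;q)_n}{(bz;q)_n}\quad\text{in }\mathbb{C}[[z]].$$ Then for every integer $n\ge1$, every $0\le k\le n$ and every $t\in\mathbb{C}$, $$B_{n,k}(at,bt)=B_{n,k}(a,b)\,t^{n-k},$$ and $$[z^{n}]\left\{\frac{(bz;q)_{n-1}}{(az;q)_{n}}\right\}=a\sum_{i=0}^{n-1}B_{n-i,1}(a,b)\,q^{(n-i)i}\,[z^{i}]\left\{\frac{(bz;q)_{i}}{(az;q)_{i+1}}\right\}.$$
   Context: $(x;q)_n=\prod_{i=0}^{n-1}(1-xq^i)$ for $n\ge0$, with $(x;q)_0=1$. Quotients of such products are expanded as formal power series in $z$, and $[z^m]\{f(z)\}$ denotes the coefficient of $z^m$ in $f\in\mathbb{C}[[z]]$. -}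

module Defs where

open import Level using (Level)
open import Algebra.Bundles using (CommutativeRing)
open import Data.Nat as ℕ using (ℕ; zero; suc; _<ᵇ_)
open import Data.Bool using (if_then_else_)

-- Formal power series in z over a commutative ring R, represented by their
-- coefficient sequences: a series f is the function m ↦ [z^m] f.
module Series {c ℓ : Level} (R : CommutativeRing c ℓ) where
  open CommutativeRing R

  Series : Set c
  Series = ℕ → Carrier

  pow : Carrier → ℕ → Carrier
  pow x zero    = 1#
  pow x (suc n) = x * pow x n

  sumLt : ℕ → (ℕ → Carrier) → Carrier
  sumLt zero    f = 0#
  sumLt (suc n) f = sumLt n f + f n

  coeff : ℕ → Series → Carrier
  coeff m f = f m

  one : Series
  one zero    = 1#
  one (suc m) = 0#

  mul : Series → Series → Series
  mul f g m = sumLt (suc m) (λ i → f i * g (m ℕ.∸ i))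

  shift : ℕ → Series → Series
  shift zero    f m       = f m
  shift (suc n) f zero    = 0#
  shift (suc n) f (suc m) = shift n f m

  lin : Carrier → Series
  lin x zero          = 1#
  lin x (suc zero)    = - x
  lin x (suc (suc m)) = 0#

  -- the power series expansion of 1/(1 - x z) = Σ_j x^j z^j
  geom : Carrier → Series
  geom x m = pow x m

  poch : Carrier → Carrier → ℕ → Series
  poch q x zero    = one
  poch q x (suc n) = mul (poch q x n) (lin (x * pow q n))

  invPoch : Carrier → Carrier → ℕ → Series
  invPoch q x zero    = one
  invPoch q x (suc n) = mul (invPoch q x n) (geom (x * pow q n))

  pochQuot : Carrier → Carrier → ℕ → Carrier → ℕ → Series
  pochQuot q y n x m = mul (poch q y n) (invPoch q x m)

  -- Formal sum Σ_n s n of a family with s n of order ≥ n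
  -- (only s 0, …, s m contribute to [z^m]).
  tsum : (ℕ → Series) → Series
  tsum s m = sumLt (suc m) (λ n → s n m)

  BTerm : Carrier → (ℕ → ℕ → Carrier) → Carrier → Carrier → ℕ → ℕ → Series
  BTerm q B a b k n =
    if n <ᵇ k then (λ _ → 0#)
    else (λ m → B n k * shift n (pochQuot q a n b n) m)

  IsBExpansion : Carrier → (Carrier → Carrier → ℕ → ℕ → Carrier) → Set (c Level.⊔ ℓ)
  IsBExpansion q B = ∀ (a b : Carrier) (k m : ℕ) →
    tsum (BTerm q (B a b) a b k) m ≈ shift k one m

module Submission where

-- Series are coefficient sequences; multiplication and division by a linear
-- factor 1 - xz are explicit coefficient recursions, and products and
-- quotients of q-Pochhammer symbols are iterates of these two operators
-- (modules SeriesCalculus, IteratedOperators, PochhammerOperators).  Moving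
-- the operators past each other gives two series identities:
--   (tyz;q)_n/(txz;q)_m is (yz;q)_n/(xz;q)_m at tz, and
--   (az;q)_m/(bz;q)_m · (bz;q)_{k+m}/(az;q)_{l+m} is (bz;q)_k/(az;q)_l at q^m z.
-- Comparing [z^n] in the expansion of z^k expresses B_{n,k} through the
-- B_{j,k} with j < n; with the first identity, strong induction on n gives
-- B_{n,k}(at,bt) = B_{n,k}(a,b) t^{n-k}.  Multiplying the expansion of z by
-- (bz;q)_n/(az;q)_{n+1} and comparing [z^n], the second identity evaluates
-- every term, and the left side is identified with a [z^{n-1}] of that series
-- by writing both in terms of Gaussian binomials and using the symmetry of
-- the q-trinomial coefficient (GaussianBinomials, PochhammerCoefficients).
-- No element 1 - q^k is assumed invertible, so every step avoids division.

open import Defs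
open import Level using (Level)
open import Algebra.Bundles using (CommutativeRing)
open import Data.Nat as ℕ using (ℕ; zero; suc; _≤_; _<_; _∸_; z≤n; s≤s; _<ᵇ_)
import Data.Nat.Properties as ℕP
open import Data.Integer as ℤ using (ℤ; +_; -[1+_]; _⊖_)
import Data.Integer.Properties as ℤP
open import Data.Sign as Sign using (Sign)
open import Data.Maybe using (Maybe; just; nothing)
open import Data.Product using (_×_; _,_)
open import Data.Sum using (inj₁; inj₂)
open import Data.Bool using (true; false; T)
open import Data.Unit using (tt)
open import Data.Empty using (⊥-elim)
open import Relation.Binary.PropositionalEquality as P using (_≡_)
open import Relation.Nullary using (yes; no)
open import Relation.Binary.Bundles using (Setoid)
import Relation.Binary.Reasoning.Setoid
open import Algebra.Solver.Ring.AlmostCommutativeRing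
  using (fromCommutativeRing; _-Raw-AlmostCommutative⟶_)

-- Its only input is the canonical homomorphism ℤ → R,
-- n ↦ n·1, which we construct and check here; integer coefficients (and
-- not those of R) are needed so that cancellations such as x - x = 0 are
-- detected by comparing normal forms.
module IntegerRingSolver {c ℓ : Level} (R : CommutativeRing c ℓ) where
  open CommutativeRing R
  open import Algebra.Properties.Ring ring
    using (-0#≈0#; -‿involutive; -‿+-comm; -‿distribˡ-*; -‿distribʳ-*)
  open import Algebra.Properties.Semiring.Mult.TCOptimised semiring
    using (×-homo-+; ×1-homo-*; 1+×) renaming (_×_ to _×ᴿ_)
  open import Relation.Binary.Reasoning.Setoid setoid

  natural : ℕ → Carrier
  natural n = n ×ᴿ 1#

  integer : ℤ → Carrier
  integer (+ n)    = natural n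
  integer -[1+ n ] = - natural (suc n)

  integer-⊖ : ∀ m n → integer (m ⊖ n) ≈ natural m - natural n
  integer-⊖ zero    zero    = sym (trans (+-congˡ -0#≈0#) (+-identityʳ _))
  integer-⊖ zero    (suc n) = sym (+-identityˡ _)
  integer-⊖ (suc m) zero    = sym (trans (+-congˡ -0#≈0#) (+-identityʳ _))
  integer-⊖ (suc m) (suc n) = begin
    integer (suc m ⊖ suc n)            ≡⟨ P.cong integer (ℤP.[1+m]⊖[1+n]≡m⊖n m n) ⟩
    integer (m ⊖ n)                    ≈⟨ integer-⊖ m n ⟩
    natural m - natural n              ≈⟨ cancel-1 (natural m) (natural n) ⟨
    (1# + natural m) - (1# + natural n) ≈⟨ +-cong (1+× m 1#) (-‿cong (1+× n 1#)) ⟨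
    natural (suc m) - natural (suc n)  ∎
    where
    cancel-1 : ∀ x y → (1# + x) - (1# + y) ≈ x - y
    cancel-1 x y = begin
      (1# + x) - (1# + y)     ≈⟨ +-congˡ (-‿+-comm 1# y) ⟨
      (1# + x) + (- 1# - y)   ≈⟨ +-assoc 1# x (- 1# - y) ⟩
      1# + (x + (- 1# - y))   ≈⟨ +-congˡ (+-assoc x (- 1#) (- y)) ⟨
      1# + ((x - 1#) - y)     ≈⟨ +-congˡ (+-congʳ (+-comm x (- 1#))) ⟩
      1# + ((- 1# + x) - y)   ≈⟨ +-congˡ (+-assoc (- 1#) x (- y)) ⟩
      1# + (- 1# + (x - y))   ≈⟨ +-assoc 1# (- 1#) (x - y) ⟨
      (1# - 1#) + (x - y)     ≈⟨ +-congʳ (-‿inverseʳ 1#) ⟩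
      0# + (x - y)            ≈⟨ +-identityˡ (x - y) ⟩
      x - y                   ∎

  integer-neg : ∀ i → integer (ℤ.- i) ≈ - integer i
  integer-neg (+ zero)  = sym -0#≈0#
  integer-neg (+ suc n) = refl
  integer-neg -[1+ n ]  = sym (-‿involutive _)

  integer-+ : ∀ i j → integer (i ℤ.+ j) ≈ integer i + integer j
  integer-+ -[1+ m ] -[1+ n ] = begin
    - natural (suc (suc (m ℕ.+ n)))      ≡⟨ P.cong (λ k → - natural (suc k)) (ℕP.+-suc m n) ⟨
    - natural (suc m ℕ.+ suc n)          ≈⟨ -‿cong (×-homo-+ 1# (suc m) (suc n)) ⟩
    - (natural (suc m) + natural (suc n)) ≈⟨ -‿+-comm _ _ ⟨
    - natural (suc m) - natural (suc n)  ∎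
  integer-+ -[1+ m ] (+ n)    = trans (integer-⊖ n (suc m)) (+-comm _ _)
  integer-+ (+ m)    -[1+ n ] = integer-⊖ m (suc n)
  integer-+ (+ m)    (+ n)    = ×-homo-+ 1# m n

  signed : Sign → Carrier → Carrier
  signed Sign.+ x = x
  signed Sign.- x = - x

  signed-cong : ∀ s {x y} → x ≈ y → signed s x ≈ signed s y
  signed-cong Sign.+ e = e
  signed-cong Sign.- e = -‿cong e

  signed-* : ∀ s t x y → signed (s Sign.* t) (x * y) ≈ signed s x * signed t y
  signed-* Sign.- Sign.- x y = trans (sym (-‿involutive _))
    (trans (-‿cong (-‿distribˡ-* x y)) (-‿distribʳ-* (- x) y))
  signed-* Sign.- Sign.+ x y = -‿distribˡ-* x y
  signed-* Sign.+ Sign.- x y = -‿distribʳ-* x y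
  signed-* Sign.+ Sign.+ x y = refl

  integer-◃ : ∀ s n → integer (s ℤ.◃ n) ≈ signed s (natural n)
  integer-◃ Sign.- zero    = sym -0#≈0#
  integer-◃ Sign.+ zero    = refl
  integer-◃ Sign.+ (suc n) = refl
  integer-◃ Sign.- (suc n) = refl

  integer-sign-abs : ∀ i → integer i ≈ signed (ℤ.sign i) (natural ℤ.∣ i ∣)
  integer-sign-abs (+ n)    = refl
  integer-sign-abs -[1+ n ] = refl

  integer-* : ∀ i j → integer (i ℤ.* j) ≈ integer i * integer j
  integer-* i j = begin
    integer (i ℤ.* j)                      ≈⟨ integer-◃ s (ℤ.∣ i ∣ ℕ.* ℤ.∣ j ∣) ⟩
    signed s (natural (ℤ.∣ i ∣ ℕ.* ℤ.∣ j ∣)) ≈⟨ signed-cong s (×1-homo-* ℤ.∣ i ∣ ℤ.∣ j ∣) ⟩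
    signed s (natural ℤ.∣ i ∣ * natural ℤ.∣ j ∣)
      ≈⟨ signed-* (ℤ.sign i) (ℤ.sign j) _ _ ⟩
    signed (ℤ.sign i) (natural ℤ.∣ i ∣) * signed (ℤ.sign j) (natural ℤ.∣ j ∣)
      ≈⟨ *-cong (integer-sign-abs i) (integer-sign-abs j) ⟨
    integer i * integer j                  ∎
    where s = ℤ.sign i Sign.* ℤ.sign j

  integerMorphism : ℤ.+-*-rawRing -Raw-AlmostCommutative⟶ fromCommutativeRing R
  integerMorphism = record
    { ⟦_⟧ = integer ; +-homo = integer-+ ; *-homo = integer-* ; -‿homo = integer-neg
    ; 0-homo = refl ; 1-homo = refl }

  weaklyDecide : (i j : ℤ) → Maybe (integer i ≈ integer j)
  weaklyDecide i j with i ℤ.≟ j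
  ... | yes P.refl = just refl
  ... | no _       = nothing

  open import Algebra.Solver.Ring ℤ.+-*-rawRing (fromCommutativeRing R)
    integerMorphism weaklyDecide public

  :0 :1 : ∀ {n} → Polynomial n
  :0 = con (+ 0)
  :1 = con (+ 1)

module SumsAndPowers {c ℓ : Level} (R : CommutativeRing c ℓ) where
  open CommutativeRing R
  open Series R
  open import Relation.Binary.Reasoning.Setoid setoid
  open IntegerRingSolver R using (solve; _:=_; _:+_; _:*_)

  sum-cong : ∀ n {f g : ℕ → Carrier} → (∀ i → i < n → f i ≈ g i) → sumLt n f ≈ sumLt n g
  sum-cong zero    f≈g = refl
  sum-cong (suc n) f≈g =
    +-cong (sum-cong n (λ i i<n → f≈g i (ℕP.m<n⇒m<1+n i<n))) (f≈g n (ℕP.n<1+n n))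

  sum-zero : ∀ n (f : ℕ → Carrier) → (∀ i → i < n → f i ≈ 0#) → sumLt n f ≈ 0#
  sum-zero n f f≈0 = trans (sum-cong n f≈0) (zero-terms n)
    where
    zero-terms : ∀ n → sumLt n (λ _ → 0#) ≈ 0#
    zero-terms zero    = refl
    zero-terms (suc n) = trans (+-identityʳ _) (zero-terms n)

  sum-truncate : ∀ {k} n (f : ℕ → Carrier) → k ≤ n →
                 (∀ i → k ≤ i → i < n → f i ≈ 0#) → sumLt n f ≈ sumLt k f
  sum-truncate zero    f z≤n vanish = refl
  sum-truncate (suc n) f k≤1+n vanish with ℕP.m≤n⇒m<n∨m≡n k≤1+n
  ... | inj₂ P.refl = refl
  ... | inj₁ k<1+n  = trans
    (+-cong (sum-truncate n f (ℕP.≤-pred k<1+n) (λ i k≤i i<n → vanish i k≤i (ℕP.m<n⇒m<1+n i<n)))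
            (vanish n (ℕP.≤-pred k<1+n) (ℕP.n<1+n n)))
    (+-identityʳ _)

  sum-+ : ∀ n (f g : ℕ → Carrier) → sumLt n (λ i → f i + g i) ≈ sumLt n f + sumLt n g
  sum-+ zero    f g = sym (+-identityʳ 0#)
  sum-+ (suc n) f g = trans (+-congʳ (sum-+ n f g))
    (solve 4 (λ a b x y → (a :+ b) :+ (x :+ y) := (a :+ x) :+ (b :+ y)) refl
      (sumLt n f) (sumLt n g) (f n) (g n))

  sum-*ˡ : ∀ n x (f : ℕ → Carrier) → x * sumLt n f ≈ sumLt n (λ i → x * f i)
  sum-*ˡ zero    x f = zeroʳ x
  sum-*ˡ (suc n) x f = trans (distribˡ x _ _) (+-congʳ (sum-*ˡ n x f))

  sum-*ʳ : ∀ n x (f : ℕ → Carrier) → sumLt n f * x ≈ sumLt n (λ i → f i * x)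
  sum-*ʳ n x f = trans (*-comm _ x)
    (trans (sum-*ˡ n x f) (sum-cong n (λ i _ → *-comm x (f i))))

  sum-first : ∀ n (f : ℕ → Carrier) → sumLt (suc n) f ≈ f 0 + sumLt n (λ i → f (suc i))
  sum-first zero    f = trans (+-identityˡ _) (sym (+-identityʳ _))
  sum-first (suc n) f = trans (+-congʳ (sum-first n f)) (+-assoc _ _ _)

  sum-reverse : ∀ n (f : ℕ → Carrier) → sumLt n f ≈ sumLt n (λ i → f (n ∸ suc i))
  sum-reverse zero    f = refl
  sum-reverse (suc n) f = begin
    sumLt n f + f n                       ≈⟨ +-congʳ (sum-reverse n f) ⟩
    sumLt n (λ i → f (n ∸ suc i)) + f n   ≈⟨ +-comm _ _ ⟩
    f n + sumLt n (λ i → f (n ∸ suc i))   ≈⟨ sum-first n (λ i → f (n ∸ i)) ⟨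
    sumLt (suc n) (λ i → f (n ∸ i))       ∎

  sum-swap : ∀ n m (F : ℕ → ℕ → Carrier) →
             sumLt n (λ i → sumLt m (F i)) ≈ sumLt m (λ j → sumLt n (λ i → F i j))
  sum-swap zero    m F = sym (sum-zero m _ (λ _ _ → refl))
  sum-swap (suc n) m F =
    trans (+-congʳ (sum-swap n m F)) (sym (sum-+ m (λ j → sumLt n (λ i → F i j)) (F n)))

  sum-split : ∀ s k (f : ℕ → Carrier) → sumLt (s ℕ.+ k) f ≈ sumLt k f + sumLt s (λ i → f (k ℕ.+ i))
  sum-split zero    k f = sym (+-identityʳ _)
  sum-split (suc s) k f = trans
    (+-cong (sum-split s k f) (reflexive (P.cong f (ℕP.+-comm s k))))
    (+-assoc _ _ _)

  pow-+ : ∀ x m n → pow x (m ℕ.+ n) ≈ pow x m * pow x n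
  pow-+ x zero    n = sym (*-identityˡ _)
  pow-+ x (suc m) n = trans (*-congˡ (pow-+ x m n)) (sym (*-assoc _ _ _))

  pow-* : ∀ x m n → pow (pow x m) n ≈ pow x (m ℕ.* n)
  pow-* x m zero    = reflexive (P.cong (pow x) (P.sym (ℕP.*-zeroʳ m)))
  pow-* x m (suc n) = begin
    pow x m * pow (pow x m) n   ≈⟨ *-congˡ (pow-* x m n) ⟩
    pow x m * pow x (m ℕ.* n)   ≈⟨ pow-+ x m (m ℕ.* n) ⟨
    pow x (m ℕ.+ m ℕ.* n)       ≡⟨ P.cong (pow x) (ℕP.*-suc m n) ⟨
    pow x (m ℕ.* suc n)         ∎

-- Multiplication by 1 - xz and division by 1 - xz are the coefficient
-- recursions  g(m+1) = f(m+1) - x f(m)  and  g(m+1) = f(m+1) + x g(m);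
-- every Pochhammer product and quotient below is an iterate of these two
-- operators, which is how the series identities are proved.
module SeriesCalculus {c ℓ : Level} (R : CommutativeRing c ℓ) where
  open CommutativeRing R hiding (zero)
  open Series R
  open import Relation.Binary.Reasoning.Setoid setoid
  open IntegerRingSolver R using (solve; _:=_; _:+_; _:*_; _:-_; :-_; :0; :1)
  open SumsAndPowers R

  infix 4 _≋_
  _≋_ : Series → Series → Set ℓ
  f ≋ g = ∀ m → f m ≈ g m

  ≋-refl : ∀ {f} → f ≋ f
  ≋-refl m = refl

  ≋-sym : ∀ {f g} → f ≋ g → g ≋ f
  ≋-sym f≋g m = sym (f≋g m)

  ≋-trans : ∀ {f g h} → f ≋ g → g ≋ h → f ≋ h
  ≋-trans f≋g g≋h m = trans (f≋g m) (g≋h m)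

  ≋-setoid : Setoid c ℓ
  ≋-setoid = record
    { Carrier = Series ; _≈_ = _≋_
    ; isEquivalence = record { refl = ≋-refl ; sym = ≋-sym ; trans = ≋-trans } }

  module ≋-Reasoning = Relation.Binary.Reasoning.Setoid ≋-setoid

  timesLin : Carrier → Series → Series
  timesLin x f zero    = f zero
  timesLin x f (suc m) = f (suc m) - x * f m

  divLin : Carrier → Series → Series
  divLin x f zero    = f zero
  divLin x f (suc m) = f (suc m) + x * divLin x f m

  dilate : Carrier → Series → Series
  dilate s f m = pow s m * f m

  timesLin-cong : ∀ {x y f g} → x ≈ y → f ≋ g → timesLin x f ≋ timesLin y g
  timesLin-cong x≈y f≋g zero    = f≋g zero
  timesLin-cong x≈y f≋g (suc m) = +-cong (f≋g (suc m)) (-‿cong (*-cong x≈y (f≋g m)))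

  divLin-cong : ∀ {x y f g} → x ≈ y → f ≋ g → divLin x f ≋ divLin y g
  divLin-cong x≈y f≋g zero    = f≋g zero
  divLin-cong x≈y f≋g (suc m) = +-cong (f≋g (suc m)) (*-cong x≈y (divLin-cong x≈y f≋g m))

  dilate-cong : ∀ s {f g} → f ≋ g → dilate s f ≋ dilate s g
  dilate-cong s f≋g m = *-congˡ (f≋g m)

  mul-cong : ∀ {f f' g g'} → f ≋ f' → g ≋ g' → mul f g ≋ mul f' g'
  mul-cong f≋f' g≋g' m = sum-cong (suc m) (λ i _ → *-cong (f≋f' i) (g≋g' (m ∸ i)))

  timesLin-divLin : ∀ x f → timesLin x (divLin x f) ≋ f
  timesLin-divLin x f zero    = refl
  timesLin-divLin x f (suc m) =
    solve 3 (λ a x g → (a :+ x :* g) :- x :* g := a) refl (f (suc m)) x (divLin x f m)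

  divLin-timesLin : ∀ x f → divLin x (timesLin x f) ≋ f
  divLin-timesLin x f zero    = refl
  divLin-timesLin x f (suc m) = begin
    timesLin x f (suc m) + x * divLin x (timesLin x f) m ≈⟨ +-congˡ (*-congˡ (divLin-timesLin x f m)) ⟩
    (f (suc m) - x * f m) + x * f m
      ≈⟨ solve 3 (λ a x b → (a :- x :* b) :+ x :* b := a) refl (f (suc m)) x (f m) ⟩
    f (suc m)                                             ∎

  timesLin-comm : ∀ x y f → timesLin x (timesLin y f) ≋ timesLin y (timesLin x f)
  timesLin-comm x y f zero          = refl
  timesLin-comm x y f (suc zero)    =
    solve 4 (λ a b x y → (a :- y :* b) :- x :* b := (a :- x :* b) :- y :* b) refl (f 1) (f 0) x y
  timesLin-comm x y f (suc (suc m)) =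
    solve 5 (λ a b d x y → (a :- y :* b) :- x :* (b :- y :* d) := (a :- x :* b) :- y :* (b :- x :* d))
      refl (f (suc (suc m))) (f (suc m)) (f m) x y

  -- multiplication and division by linear factors commute, since division
  -- is inverse to multiplication
  timesLin-divLin-comm : ∀ x y f → timesLin x (divLin y f) ≋ divLin y (timesLin x f)
  timesLin-divLin-comm x y f = ≋-trans (≋-sym (divLin-timesLin y _))
    (divLin-cong refl (≋-trans (timesLin-comm y x _) (timesLin-cong refl (timesLin-divLin y f))))

  mul-timesLin : ∀ x f g → mul f (timesLin x g) ≋ timesLin x (mul f g)
  mul-timesLin x f g zero    = refl
  mul-timesLin x f g (suc m) = begin
    sumLt (suc m) (λ i → f i * timesLin x g (suc m ∸ i)) + f (suc m) * timesLin x g (m ∸ m)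
      ≈⟨ +-cong (sum-cong (suc m) (λ i i≤m → term i (ℕP.≤-pred i≤m)))
                (*-congˡ (reflexive last)) ⟩
    sumLt (suc m) (λ i → f i * g (suc m ∸ i) - x * (f i * g (m ∸ i))) + f (suc m) * g (m ∸ m)
      ≈⟨ +-congʳ (sum-linear (suc m)) ⟩
    (sumLt (suc m) (λ i → f i * g (suc m ∸ i)) - x * mul f g m) + f (suc m) * g (m ∸ m)
      ≈⟨ solve 4 (λ a x b c → (a :- x :* b) :+ c := (a :+ c) :- x :* b) refl _ x _ _ ⟩
    mul f g (suc m) - x * mul f g m
      ∎
    where
    last : timesLin x g (m ∸ m) ≡ g (m ∸ m)
    last = P.trans (P.cong (timesLin x g) (ℕP.n∸n≡0 m)) (P.cong g (P.sym (ℕP.n∸n≡0 m)))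
    term : ∀ i → i ≤ m → f i * timesLin x g (suc m ∸ i) ≈ f i * g (suc m ∸ i) - x * (f i * g (m ∸ i))
    term i i≤m = begin
      f i * timesLin x g (suc m ∸ i)         ≡⟨ P.cong (λ j → f i * timesLin x g j) (ℕP.+-∸-assoc 1 i≤m) ⟩
      f i * (g (suc (m ∸ i)) - x * g (m ∸ i))
        ≈⟨ solve 4 (λ f a x b → f :* (a :- x :* b) := f :* a :- x :* (f :* b)) refl _ _ x _ ⟩
      f i * g (suc (m ∸ i)) - x * (f i * g (m ∸ i))
        ≡⟨ P.cong (λ j → f i * g j - x * (f i * g (m ∸ i))) (ℕP.+-∸-assoc 1 i≤m) ⟨
      f i * g (suc m ∸ i) - x * (f i * g (m ∸ i)) ∎
    sum-linear : ∀ n → sumLt n (λ i → f i * g (suc m ∸ i) - x * (f i * g (m ∸ i)))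
                       ≈ sumLt n (λ i → f i * g (suc m ∸ i)) - x * sumLt n (λ i → f i * g (m ∸ i))
    sum-linear zero    = solve 1 (λ x → :0 := :0 :- x :* :0) refl x
    sum-linear (suc n) = trans (+-congʳ (sum-linear n))
      (solve 5 (λ a b u v x → (a :- x :* b) :+ (u :- x :* v) := (a :+ u) :- x :* (b :+ v)) refl _ _ _ _ x)

  mul-divLin : ∀ x f g → mul f (divLin x g) ≋ divLin x (mul f g)
  mul-divLin x f g = ≋-trans (≋-sym (divLin-timesLin x _))
    (divLin-cong refl (≋-trans (≋-sym (mul-timesLin x f (divLin x g)))
                                (mul-cong ≋-refl (timesLin-divLin x g))))

  timesLin-dilate : ∀ s x f → timesLin (s * x) (dilate s f) ≋ dilate s (timesLin x f)
  timesLin-dilate s x f zero    = refl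
  timesLin-dilate s x f (suc m) =
    solve 5 (λ s p a x b → s :* p :* a :- (s :* x) :* (p :* b) := s :* p :* (a :- x :* b))
      refl s (pow s m) (f (suc m)) x (f m)

  divLin-dilate : ∀ s x f → divLin (s * x) (dilate s f) ≋ dilate s (divLin x f)
  divLin-dilate s x f zero    = refl
  divLin-dilate s x f (suc m) = begin
    s * pow s m * f (suc m) + (s * x) * divLin (s * x) (dilate s f) m
      ≈⟨ +-congˡ (*-congˡ (divLin-dilate s x f m)) ⟩
    s * pow s m * f (suc m) + (s * x) * (pow s m * divLin x f m)
      ≈⟨ solve 5 (λ s p a x b → s :* p :* a :+ (s :* x) :* (p :* b) := s :* p :* (a :+ x :* b))
           refl s (pow s m) (f (suc m)) x (divLin x f m) ⟩
    s * pow s m * (f (suc m) + x * divLin x f m) ∎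

  dilate-one : ∀ s → dilate s one ≋ one
  dilate-one s zero    = *-identityʳ 1#
  dilate-one s (suc m) = zeroʳ _

  mul-one : ∀ f → mul f one ≋ f
  mul-one f m = begin
    sumLt m (λ i → f i * one (m ∸ i)) + f m * one (m ∸ m)
      ≈⟨ +-cong (sum-zero m _ (λ i i<m → trans (*-congˡ (reflexive (P.cong one (ℕP.+-∸-assoc 1 i<m)))) (zeroʳ _)))
                (*-congˡ (reflexive (P.cong one (ℕP.n∸n≡0 m)))) ⟩
    0# + f m * 1# ≈⟨ solve 1 (λ a → :0 :+ a :* :1 := a) refl (f m) ⟩
    f m           ∎

  one-mul : ∀ f → mul one f ≋ f
  one-mul f m = begin
    mul one f m                                     ≈⟨ sum-first m (λ i → one i * f (m ∸ i)) ⟩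
    1# * f m + sumLt m (λ i → 0# * f (m ∸ suc i))   ≈⟨ +-cong (*-identityˡ _) (sum-zero m _ (λ i _ → zeroˡ _)) ⟩
    f m + 0#                                        ≈⟨ +-identityʳ _ ⟩
    f m                                             ∎

  lin-timesLin : ∀ x → lin x ≋ timesLin x one
  lin-timesLin x zero          = refl
  lin-timesLin x (suc zero)    = solve 1 (λ x → :- x := :0 :- x :* :1) refl x
  lin-timesLin x (suc (suc m)) = solve 1 (λ x → :0 := :0 :- x :* :0) refl x

  geom-divLin : ∀ x → geom x ≋ divLin x one
  geom-divLin x zero    = refl
  geom-divLin x (suc m) = trans (*-congˡ (geom-divLin x m)) (sym (+-identityˡ _))

  mul-lin : ∀ x f → mul f (lin x) ≋ timesLin x f
  mul-lin x f = ≋-trans (mul-cong ≋-refl (lin-timesLin x))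
    (≋-trans (mul-timesLin x f one) (timesLin-cong refl (mul-one f)))

  mul-geom : ∀ x f → mul f (geom x) ≋ divLin x f
  mul-geom x f = ≋-trans (mul-cong ≋-refl (geom-divLin x))
    (≋-trans (mul-divLin x f one) (divLin-cong refl (mul-one f)))

  shift-below : ∀ k f j → j < k → shift k f j ≡ 0#
  shift-below (suc k) f zero    _         = P.refl
  shift-below (suc k) f (suc j) (s≤s j<k) = shift-below k f j j<k

  shift-+ : ∀ k f j → shift k f (k ℕ.+ j) ≡ f j
  shift-+ zero    f j = P.refl
  shift-+ (suc k) f j = shift-+ k f j

  shift-above : ∀ k f n → k ≤ n → shift k f n ≡ f (n ∸ k)
  shift-above k f n k≤n =
    P.trans (P.cong (shift k f) (P.sym (ℕP.m+[n∸m]≡n k≤n))) (shift-+ k f (n ∸ k))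

  mul-shift : ∀ k f g n → k ≤ n → mul (shift k f) g n ≈ mul f g (n ∸ k)
  mul-shift k f g n k≤n = begin
    sumLt (suc n) h                       ≡⟨ P.cong (λ t → sumLt (suc t) h) (ℕP.m∸n+n≡m k≤n) ⟨
    sumLt (suc (n ∸ k) ℕ.+ k) h           ≈⟨ sum-split (suc (n ∸ k)) k h ⟩
    sumLt k h + sumLt (suc (n ∸ k)) (λ i → h (k ℕ.+ i))
      ≈⟨ +-cong (sum-zero k h (λ i i<k → trans (*-congʳ (reflexive (shift-below k f i i<k))) (zeroˡ _)))
                (sum-cong (suc (n ∸ k)) (λ i _ → *-cong (reflexive (shift-+ k f i))
                                                       (reflexive (P.cong g (P.sym (ℕP.∸-+-assoc n k i)))))) ⟩
    0# + mul f g (n ∸ k)                  ≈⟨ +-identityˡ _ ⟩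
    mul f g (n ∸ k)                       ∎
    where
    h : ℕ → Carrier
    h i = shift k f i * g (n ∸ i)

  mul-tsum : ∀ (s : ℕ → Series) g n → (∀ m j → j < m → s m j ≈ 0#) →
             mul (tsum s) g n ≈ sumLt (suc n) (λ m → mul (s m) g n)
  mul-tsum s g n order = begin
    sumLt (suc n) (λ j → sumLt (suc j) (λ m → s m j) * g (n ∸ j))
      ≈⟨ sum-cong (suc n) (λ j j≤n → trans (*-congʳ (sym (extend j j≤n))) (sum-*ʳ (suc n) _ _)) ⟩
    sumLt (suc n) (λ j → sumLt (suc n) (λ m → s m j * g (n ∸ j))) ≈⟨ sum-swap (suc n) (suc n) _ ⟩
    sumLt (suc n) (λ m → mul (s m) g n)                           ∎
    where
    extend : ∀ j → j < suc n → sumLt (suc n) (λ m → s m j) ≈ sumLt (suc j) (λ m → s m j)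
    extend j j<1+n = sum-truncate (suc n) (λ m → s m j) j<1+n (λ m j<m _ → order m j j<m)

module IteratedOperators {c ℓ : Level} (R : CommutativeRing c ℓ) where
  open Series R
  open SeriesCalculus R

  Operator : Set c
  Operator = Series → Series

  Congruent : Operator → Set (c Level.⊔ ℓ)
  Congruent op = ∀ {f g} → f ≋ g → op f ≋ op g

  Intertwines : Operator → Operator → Operator → Set (c Level.⊔ ℓ)
  Intertwines S op op' = ∀ f → op' (S f) ≋ S (op f)

  iter : (ℕ → Operator) → ℕ → Operator
  iter op zero    f = f
  iter op (suc k) f = op k (iter op k f)

  iter-cong : ∀ {op op' : ℕ → Operator} → (∀ i → Congruent (op i)) → (∀ i f → op i f ≋ op' i f) →
              ∀ k {f g} → f ≋ g → iter op k f ≋ iter op' k g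
  iter-cong cong-op op≋op' zero    f≋g = f≋g
  iter-cong cong-op op≋op' (suc k) f≋g =
    ≋-trans (cong-op k (iter-cong cong-op op≋op' k f≋g)) (op≋op' k _)

  iter-intertwines : ∀ {S} {op op' : ℕ → Operator} → (∀ i → Congruent (op' i)) →
                     (∀ i → Intertwines S (op i) (op' i)) → ∀ k → Intertwines S (iter op k) (iter op' k)
  iter-intertwines cong-op' S-op zero    f = ≋-refl
  iter-intertwines cong-op' S-op (suc k) f =
    ≋-trans (cong-op' k (iter-intertwines cong-op' S-op k f)) (S-op k _)

  iter-split : ∀ {op : ℕ → Operator} → (∀ i → Congruent (op i)) →
               ∀ k m f → iter op (k ℕ.+ m) f ≋ iter (λ i → op (i ℕ.+ m)) k (iter op m f)
  iter-split cong-op zero    m f = ≋-refl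
  iter-split cong-op (suc k) m f = cong-op (k ℕ.+ m) (iter-split cong-op k m f)

  iter-cancel : ∀ {op inv : ℕ → Operator} → (∀ i → Congruent (inv i)) →
                (∀ i f → inv i (op i f) ≋ f) → (∀ i j → Intertwines (op j) (inv i) (inv i)) →
                ∀ k f → iter inv k (iter op k f) ≋ f
  iter-cancel cong-inv inv-op commute zero    f = ≋-refl
  iter-cancel cong-inv inv-op commute (suc k) f =
    ≋-trans (cong-inv k (iter-intertwines cong-inv (λ i → commute i k) k _))
    (≋-trans (inv-op k _) (iter-cancel cong-inv inv-op commute k f))

module PochhammerOperators {c ℓ : Level} (R : CommutativeRing c ℓ) (q : CommutativeRing.Carrier R) where
  open CommutativeRing R hiding (zero)
  open Series R
  open IntegerRingSolver R using (solve; _:=_; _:*_)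
  open SumsAndPowers R
  open SeriesCalculus R
  open IteratedOperators R

  timesPoch divPoch : Carrier → ℕ → Operator
  timesPoch x = iter (λ i → timesLin (x * pow q i))
  divPoch   x = iter (λ i → divLin (x * pow q i))

  timesLin-congruent : ∀ x → Congruent (timesLin x)
  timesLin-congruent x = timesLin-cong refl

  divLin-congruent : ∀ x → Congruent (divLin x)
  divLin-congruent x = divLin-cong refl

  timesPoch-cong : ∀ {x y} k {f g} → x ≈ y → f ≋ g → timesPoch x k f ≋ timesPoch y k g
  timesPoch-cong k x≈y = iter-cong (λ i → timesLin-congruent _) (λ i f → timesLin-cong (*-congʳ x≈y) ≋-refl) k

  divPoch-cong : ∀ {x y} k {f g} → x ≈ y → f ≋ g → divPoch x k f ≋ divPoch y k g
  divPoch-cong k x≈y = iter-cong (λ i → divLin-congruent _) (λ i f → divLin-cong (*-congʳ x≈y) ≋-refl) k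

  poch-timesPoch : ∀ x k → poch q x k ≋ timesPoch x k one
  poch-timesPoch x zero    = ≋-refl
  poch-timesPoch x (suc k) = ≋-trans (mul-lin _ _) (timesLin-cong refl (poch-timesPoch x k))

  mul-divPoch : ∀ x k f g → mul f (divPoch x k g) ≋ divPoch x k (mul f g)
  mul-divPoch x k f g = ≋-sym
    (iter-intertwines (λ i → divLin-congruent _) (λ i g → ≋-sym (mul-divLin _ f g)) k g)

  mul-timesPoch : ∀ x k f g → mul f (timesPoch x k g) ≋ timesPoch x k (mul f g)
  mul-timesPoch x k f g = ≋-sym
    (iter-intertwines (λ i → timesLin-congruent _) (λ i g → ≋-sym (mul-timesLin _ f g)) k g)

  mul-invPoch : ∀ x k f → mul f (invPoch q x k) ≋ divPoch x k f
  mul-invPoch x zero    f = mul-one f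
  mul-invPoch x (suc k) f = ≋-trans (mul-cong ≋-refl (mul-geom _ _))
    (≋-trans (mul-divLin _ f _) (divLin-cong refl (mul-invPoch x k f)))

  pochQuot-operators : ∀ y n x m → pochQuot q y n x m ≋ divPoch x m (timesPoch y n one)
  pochQuot-operators y n x m = ≋-trans (mul-invPoch x m _) (divPoch-cong m refl (poch-timesPoch y n))

  timesPoch-divPoch : ∀ y k x m f → timesPoch y k (divPoch x m f) ≋ divPoch x m (timesPoch y k f)
  timesPoch-divPoch y k x m f = ≋-sym (iter-intertwines {S = timesPoch y k} (λ i → divLin-congruent _)
    (λ i g → ≋-sym (iter-intertwines (λ j → timesLin-congruent _) (λ j → timesLin-divLin-comm _ _) k g)) m f)

  timesPoch-cancel : ∀ x k f → timesPoch x k (divPoch x k f) ≋ f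
  timesPoch-cancel x = iter-cancel (λ i → timesLin-congruent _) (λ i → timesLin-divLin _)
    (λ i j f → timesLin-divLin-comm _ _ f)

  divPoch-cancel : ∀ x k f → divPoch x k (timesPoch x k f) ≋ f
  divPoch-cancel x = iter-cancel (λ i → divLin-congruent _) (λ i → divLin-timesLin _)
    (λ i j f → ≋-sym (timesLin-divLin-comm _ _ f))

  -- (xz;q)_{k+m} = (xz;q)_m (xq^m z;q)_k, for both operators
  factor-split : ∀ x m i → x * pow q (i ℕ.+ m) ≈ (x * pow q m) * pow q i
  factor-split x m i = trans (*-congˡ (pow-+ q i m))
    (solve 3 (λ x a b → x :* (a :* b) := (x :* b) :* a) refl x (pow q i) (pow q m))

  timesPoch-split : ∀ x k m f → timesPoch x (k ℕ.+ m) f ≋ timesPoch (x * pow q m) k (timesPoch x m f)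
  timesPoch-split x k m f = ≋-trans (iter-split (λ i → timesLin-congruent _) k m f)
    (iter-cong (λ i → timesLin-congruent _) (λ i f → timesLin-cong (factor-split x m i) ≋-refl) k ≋-refl)

  divPoch-split : ∀ x k m f → divPoch x (k ℕ.+ m) f ≋ divPoch (x * pow q m) k (divPoch x m f)
  divPoch-split x k m f = ≋-trans (iter-split (λ i → divLin-congruent _) k m f)
    (iter-cong (λ i → divLin-congruent _) (λ i f → divLin-cong (factor-split x m i) ≋-refl) k ≋-refl)

  pochQuot-dilate : ∀ t y n x m → pochQuot q (y * t) n (x * t) m ≋ dilate t (pochQuot q y n x m)
  pochQuot-dilate t y n x m = begin
    pochQuot q (y * t) n (x * t) m                      ≈⟨ pochQuot-operators (y * t) n (x * t) m ⟩
    divPoch (x * t) m (timesPoch (y * t) n one)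
      ≈⟨ divPoch-cong m (*-comm x t) (timesPoch-cong n (*-comm y t) (≋-sym (dilate-one t))) ⟩
    divPoch (t * x) m (timesPoch (t * y) n (dilate t one)) ≈⟨ divPoch-cong m refl (dilate-timesPoch y n one) ⟩
    divPoch (t * x) m (dilate t (timesPoch y n one))     ≈⟨ dilate-divPoch x m _ ⟩
    dilate t (divPoch x m (timesPoch y n one))           ≈⟨ dilate-cong t (pochQuot-operators y n x m) ⟨
    dilate t (pochQuot q y n x m)                        ∎
    where
    open ≋-Reasoning
    assoc-factor : ∀ x i → (t * x) * pow q i ≈ t * (x * pow q i)
    assoc-factor x i = *-assoc t x (pow q i)
    dilate-timesPoch : ∀ y k → Intertwines (dilate t) (timesPoch y k) (timesPoch (t * y) k)
    dilate-timesPoch y = iter-intertwines (λ i → timesLin-congruent _)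
      (λ i f → ≋-trans (timesLin-cong (assoc-factor y i) ≋-refl) (timesLin-dilate t _ f))
    dilate-divPoch : ∀ x k → Intertwines (dilate t) (divPoch x k) (divPoch (t * x) k)
    dilate-divPoch x = iter-intertwines (λ i → divLin-congruent _)
      (λ i f → ≋-trans (divLin-cong (assoc-factor x i) ≋-refl) (divLin-dilate t _ f))

  pochQuot-product : ∀ a b m k l →
    mul (pochQuot q a m b m) (pochQuot q b (k ℕ.+ m) a (l ℕ.+ m)) ≋ dilate (pow q m) (pochQuot q b k a l)
  pochQuot-product a b m k l = begin
    mul Q (pochQuot q b (k ℕ.+ m) a (l ℕ.+ m))
      ≈⟨ mul-cong ≋-refl (pochQuot-operators b (k ℕ.+ m) a (l ℕ.+ m)) ⟩
    mul Q (divPoch a (l ℕ.+ m) (timesPoch b (k ℕ.+ m) one))      ≈⟨ mul-divPoch a (l ℕ.+ m) Q _ ⟩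
    divPoch a (l ℕ.+ m) (mul Q (timesPoch b (k ℕ.+ m) one))
      ≈⟨ divPoch-cong (l ℕ.+ m) refl (mul-timesPoch b (k ℕ.+ m) Q one) ⟩
    divPoch a (l ℕ.+ m) (timesPoch b (k ℕ.+ m) (mul Q one))
      ≈⟨ divPoch-cong (l ℕ.+ m) refl (timesPoch-cong (k ℕ.+ m) refl
           (≋-trans (mul-one Q) (pochQuot-operators a m b m))) ⟩
    divPoch a (l ℕ.+ m) (timesPoch b (k ℕ.+ m) (divPoch b m A))
      ≈⟨ divPoch-cong (l ℕ.+ m) refl (timesPoch-split b k m _) ⟩
    divPoch a (l ℕ.+ m) (timesPoch (b * s) k (timesPoch b m (divPoch b m A)))
      ≈⟨ divPoch-cong (l ℕ.+ m) refl (timesPoch-cong k refl (timesPoch-cancel b m A)) ⟩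
    divPoch a (l ℕ.+ m) (timesPoch (b * s) k A)                  ≈⟨ divPoch-split a l m _ ⟩
    divPoch (a * s) l (divPoch a m (timesPoch (b * s) k A))
      ≈⟨ divPoch-cong l refl (timesPoch-divPoch (b * s) k a m A) ⟨
    divPoch (a * s) l (timesPoch (b * s) k (divPoch a m A))
      ≈⟨ divPoch-cong l refl (timesPoch-cong k refl (divPoch-cancel a m one)) ⟩
    divPoch (a * s) l (timesPoch (b * s) k one)                  ≈⟨ pochQuot-operators (b * s) k (a * s) l ⟨
    pochQuot q (b * s) k (a * s) l                               ≈⟨ pochQuot-dilate s b k a l ⟩
    dilate s (pochQuot q b k a l)                                ∎
    where
    open ≋-Reasoning
    s = pow q m
    Q = pochQuot q a m b m
    A = timesPoch a m one

-- Since 1 - q^k need not be invertible, every identity is proved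
-- from recursions: a relation (1 - v)X = (1 - u)Y is only ever used through
-- Y + vX = X + uY (lemma balance), never by cancelling a factor.
module GaussianBinomials {c ℓ : Level} (R : CommutativeRing c ℓ) (q : CommutativeRing.Carrier R) where
  open CommutativeRing R hiding (zero)
  open Series R
  open import Relation.Binary.Reasoning.Setoid setoid
  open IntegerRingSolver R using (solve; _:=_; _:+_; _:*_; _:-_; :1)
  open SumsAndPowers R

  q^ : ℕ → Carrier
  q^ n = pow q n

  -- gauss x y = [x+y choose x]_q = h_x(1, q, …, q^y), by the Pascal recursion
  -- [x+y+2 choose x+1] = [x+y+1 choose x+1] + q^{y+1} [x+y+1 choose x]
  gauss : ℕ → ℕ → Carrier
  gauss zero    y       = 1#
  gauss (suc x) zero    = 1#
  gauss (suc x) (suc y) = gauss (suc x) y + q^ (suc y) * gauss x (suc y)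

  gauss-x0 : ∀ x → gauss x 0 ≡ 1#
  gauss-x0 zero    = P.refl
  gauss-x0 (suc x) = P.refl

  balance : ∀ u v X Y → (1# - v) * X ≈ (1# - u) * Y → Y + v * X ≈ X + u * Y
  balance u v X Y h = begin
    Y + v * X
      ≈⟨ solve 4 (λ u v X Y → Y :+ v :* X := (X :+ u :* Y) :+ ((:1 :- u) :* Y :- (:1 :- v) :* X)) refl u v X Y ⟩
    (X + u * Y) + ((1# - u) * Y - (1# - v) * X) ≈⟨ +-congˡ (+-congˡ (-‿cong h)) ⟩
    (X + u * Y) + ((1# - u) * Y - (1# - u) * Y)
      ≈⟨ solve 2 (λ a b → a :+ (b :- b) := a) refl (X + u * Y) ((1# - u) * Y) ⟩
    X + u * Y                                   ∎

  gauss-x1 : ∀ x → (1# - q) * gauss x 1 ≈ 1# - q^ (suc x)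
  gauss-x1 zero    = solve 1 (λ q → (:1 :- q) :* :1 := :1 :- q :* :1) refl q
  gauss-x1 (suc x) = begin
    (1# - q) * (1# + (q * 1#) * gauss x 1)
      ≈⟨ solve 2 (λ q g → (:1 :- q) :* (:1 :+ (q :* :1) :* g)
                        := (:1 :- q) :+ q :* ((:1 :- q) :* g)) refl q (gauss x 1) ⟩
    (1# - q) + q * ((1# - q) * gauss x 1)  ≈⟨ +-congˡ (*-congˡ (gauss-x1 x)) ⟩
    (1# - q) + q * (1# - q^ (suc x))
      ≈⟨ solve 2 (λ q u → (:1 :- q) :+ q :* (:1 :- u) := :1 :- q :* u) refl q (q^ (suc x)) ⟩
    1# - q^ (suc (suc x))                  ∎

  gauss-1y : ∀ y → (1# - q) * gauss 1 y ≈ 1# - q^ (suc y)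
  gauss-1y zero    = solve 1 (λ q → (:1 :- q) :* :1 := :1 :- q :* :1) refl q
  gauss-1y (suc y) = begin
    (1# - q) * (gauss 1 y + q^ (suc y) * 1#)
      ≈⟨ solve 3 (λ q g u → (:1 :- q) :* (g :+ u :* :1)
                          := (:1 :- q) :* g :+ (:1 :- q) :* u) refl q (gauss 1 y) (q^ (suc y)) ⟩
    (1# - q) * gauss 1 y + (1# - q) * q^ (suc y) ≈⟨ +-congʳ (gauss-1y y) ⟩
    (1# - q^ (suc y)) + (1# - q) * q^ (suc y)
      ≈⟨ solve 2 (λ q u → (:1 :- u) :+ (:1 :- q) :* u := :1 :- q :* u) refl q (q^ (suc y)) ⟩
    1# - q^ (suc (suc y))                         ∎

  gauss-absorb : ∀ x y → (1# - q^ (suc y)) * gauss x (suc y) ≈ (1# - q^ (suc x)) * gauss (suc x) y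
  gauss-absorb x       zero    =
    trans (*-congʳ (+-congˡ (-‿cong (*-identityʳ q)))) (trans (gauss-x1 x) (sym (*-identityʳ _)))
  gauss-absorb zero    (suc y) =
    trans (*-identityʳ _) (sym (trans (*-congʳ (+-congˡ (-‿cong (*-identityʳ q)))) (gauss-1y (suc y))))
  gauss-absorb (suc x) (suc y) = begin
    (1# - q * v) * (g + (q * v) * gauss x (suc (suc y)))
      ≈⟨ solve 4 (λ q v g h → (:1 :- q :* v) :* (g :+ (q :* v) :* h)
                            := (:1 :- q :* v) :* g :+ q :* v :* ((:1 :- q :* v) :* h))
           refl q v g (gauss x (suc (suc y))) ⟩
    (1# - q * v) * g + q * v * ((1# - q * v) * gauss x (suc (suc y))) ≈⟨ +-congˡ (*-congˡ (gauss-absorb x (suc y))) ⟩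
    (1# - q * v) * g + q * v * ((1# - u) * g)
      ≈⟨ solve 4 (λ q u v g → (:1 :- q :* v) :* g :+ q :* v :* ((:1 :- u) :* g)
                            := (:1 :- v) :* g :+ v :* (:1 :- q :* u) :* g) refl q u v g ⟩
    (1# - v) * g + v * (1# - q * u) * g                              ≈⟨ +-congʳ (gauss-absorb (suc x) y) ⟩
    (1# - q * u) * gauss (suc (suc x)) y + v * (1# - q * u) * g
      ≈⟨ solve 5 (λ q u v g h → (:1 :- q :* u) :* h :+ v :* (:1 :- q :* u) :* g
                              := (:1 :- q :* u) :* (h :+ v :* g)) refl q u v g (gauss (suc (suc x)) y) ⟩
    (1# - q * u) * (gauss (suc (suc x)) y + v * g)                   ∎
    where
    u = q^ (suc x)
    v = q^ (suc y)
    g = gauss (suc x) (suc y)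

  -- the second Pascal rule, equivalent to the first by absorption
  gauss-pascal : ∀ x y → gauss (suc x) (suc y) ≈ gauss x (suc y) + q^ (suc x) * gauss (suc x) y
  gauss-pascal x y = balance (q^ (suc x)) (q^ (suc y)) (gauss x (suc y)) (gauss (suc x) y) (gauss-absorb x y)

  gauss-sym : ∀ x y → gauss x y ≈ gauss y x
  gauss-sym zero    zero    = refl
  gauss-sym zero    (suc y) = refl
  gauss-sym (suc x) zero    = refl
  gauss-sym (suc x) (suc y) = begin
    gauss (suc x) (suc y)                          ≈⟨ gauss-pascal x y ⟩
    gauss x (suc y) + q^ (suc x) * gauss (suc x) y
      ≈⟨ +-cong (sym (gauss-sym (suc y) x)) (*-congˡ (gauss-sym (suc x) y)) ⟩
    gauss (suc y) x + q^ (suc x) * gauss y (suc x) ∎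

  gauss-absorb-top : ∀ x y → (1# - q^ (suc y)) * gauss x (suc y) ≈ (1# - q^ (suc (x ℕ.+ y))) * gauss x y
  gauss-absorb-top zero    y = refl
  gauss-absorb-top (suc x) y = begin
    (1# - v) * (g + v * gauss x (suc y))
      ≈⟨ solve 3 (λ v h g → (:1 :- v) :* (g :+ v :* h)
                          := (:1 :- v) :* g :+ v :* ((:1 :- v) :* h)) refl v (gauss x (suc y)) g ⟩
    (1# - v) * g + v * ((1# - v) * gauss x (suc y)) ≈⟨ +-congˡ (*-congˡ (gauss-absorb x y)) ⟩
    (1# - v) * g + v * ((1# - u) * g)
      ≈⟨ solve 3 (λ u v g → (:1 :- v) :* g :+ v :* ((:1 :- u) :* g) := (:1 :- u :* v) :* g) refl u v g ⟩
    (1# - u * v) * g                                ≈⟨ *-congʳ (+-congˡ (-‿cong (sym uv))) ⟩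
    (1# - q^ (suc (suc x ℕ.+ y))) * g               ∎
    where
    u = q^ (suc x)
    v = q^ (suc y)
    g = gauss (suc x) y
    uv : q^ (suc (suc x ℕ.+ y)) ≈ u * v
    uv = trans (reflexive (P.cong (λ k → q^ (suc k)) (P.sym (ℕP.+-suc x y)))) (pow-+ q (suc x) (suc y))

  trinomial : ℕ → ℕ → ℕ → Carrier
  trinomial x y z = gauss x y * gauss (x ℕ.+ y) z

  trinomial-absorb : ∀ x y z → (1# - q^ (suc z)) * trinomial x y (suc z) ≈ (1# - q^ (suc y)) * trinomial x (suc y) z
  trinomial-absorb x y z = begin
    (1# - q^ (suc z)) * (gauss x y * gauss (x ℕ.+ y) (suc z))
      ≈⟨ solve 3 (λ a b c → a :* (b :* c) := b :* (a :* c)) refl _ _ _ ⟩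
    gauss x y * ((1# - q^ (suc z)) * gauss (x ℕ.+ y) (suc z)) ≈⟨ *-congˡ (gauss-absorb (x ℕ.+ y) z) ⟩
    gauss x y * ((1# - q^ (suc (x ℕ.+ y))) * gauss (suc (x ℕ.+ y)) z)
      ≈⟨ solve 3 (λ a b c → b :* (a :* c) := (a :* b) :* c) refl _ _ _ ⟩
    ((1# - q^ (suc (x ℕ.+ y))) * gauss x y) * gauss (suc (x ℕ.+ y)) z
      ≈⟨ *-cong (sym (gauss-absorb-top x y)) (reflexive (P.cong (λ k → gauss k z) (P.sym (ℕP.+-suc x y)))) ⟩
    ((1# - q^ (suc y)) * gauss x (suc y)) * gauss (x ℕ.+ suc y) z ≈⟨ *-assoc _ _ _ ⟩
    (1# - q^ (suc y)) * trinomial x (suc y) z                      ∎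

  trinomial-pascal : ∀ x y z → trinomial (suc x) (suc y) (suc z) ≈
    (trinomial x (suc y) (suc z) + q^ (suc x) * trinomial (suc x) y (suc z))
      + q^ (suc (x ℕ.+ suc y)) * trinomial (suc x) (suc y) z
  trinomial-pascal x y z = begin
    gauss (suc x) (suc y) * gauss (suc s) (suc z)
      ≈⟨ *-cong (gauss-pascal x y) (gauss-pascal s z) ⟩
    (gauss x (suc y) + u * gauss (suc x) y) * (gauss s (suc z) + w * gauss (suc s) z)
      ≈⟨ solve 6 (λ a u b d w e → (a :+ u :* b) :* (d :+ w :* e)
                                := (a :* d :+ u :* (b :* d)) :+ w :* ((a :+ u :* b) :* e))
           refl _ _ _ _ _ _ ⟩
    (gauss x (suc y) * gauss s (suc z) + u * (gauss (suc x) y * gauss s (suc z)))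
      + w * ((gauss x (suc y) + u * gauss (suc x) y) * gauss (suc s) z)
      ≈⟨ +-cong (+-congˡ (*-congˡ (*-congˡ (reflexive (P.cong (λ k → gauss k (suc z)) (ℕP.+-suc x y))))))
                (*-congˡ (*-congʳ (sym (gauss-pascal x y)))) ⟩
    (trinomial x (suc y) (suc z) + u * trinomial (suc x) y (suc z)) + w * trinomial (suc x) (suc y) z ∎
    where
    s = x ℕ.+ suc y
    u = q^ (suc x)
    w = q^ (suc s)

  trinomial-sym : ∀ x y z → trinomial x y z ≈ trinomial x z y
  trinomial-sym zero    y       z       = trans (*-identityˡ _) (trans (gauss-sym y z) (sym (*-identityˡ _)))
  trinomial-sym (suc x) zero    z       = trans (*-identityˡ _)
    (trans (reflexive (P.cong (λ k → gauss (suc k) z) (ℕP.+-identityʳ x))) (sym (*-identityʳ _)))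
  trinomial-sym (suc x) (suc y) zero    = sym (trinomial-sym (suc x) zero (suc y))
  trinomial-sym (suc x) (suc y) (suc z) = begin
    trinomial (suc x) (suc y) (suc z) ≈⟨ trinomial-pascal x y z ⟩
    (trinomial x (suc y) (suc z) + u * trinomial (suc x) y (suc z))
      + q^ (suc (x ℕ.+ suc y)) * trinomial (suc x) (suc y) z
      ≈⟨ +-cong (+-cong (trinomial-sym x (suc y) (suc z)) (*-congˡ (trinomial-sym (suc x) y (suc z))))
                (*-cong (pow-+ q (suc x) (suc y)) (trinomial-sym (suc x) (suc y) z)) ⟩
    (trinomial x (suc z) (suc y) + u * U) + (u * vy) * V
      ≈⟨ solve 5 (λ a u U V vy → (a :+ u :* U) :+ (u :* vy) :* V := a :+ u :* (U :+ vy :* V)) refl _ u U V vy ⟩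
    trinomial x (suc z) (suc y) + u * (U + vy * V)
      ≈⟨ +-congˡ (*-congˡ (balance vz vy V U (trinomial-absorb (suc x) z y))) ⟩
    trinomial x (suc z) (suc y) + u * (V + vz * U)
      ≈⟨ solve 5 (λ a u U V vz → a :+ u :* (V :+ vz :* U) := (a :+ u :* V) :+ (u :* vz) :* U) refl _ u U V vz ⟩
    (trinomial x (suc z) (suc y) + u * V) + (u * vz) * U ≈⟨ +-congˡ (*-congʳ (sym (pow-+ q (suc x) (suc z)))) ⟩
    (trinomial x (suc z) (suc y) + u * trinomial (suc x) z (suc y))
      + q^ (suc (x ℕ.+ suc z)) * trinomial (suc x) (suc z) y
      ≈⟨ trinomial-pascal x z y ⟨
    trinomial (suc x) (suc z) (suc y) ∎
    where
    u  = q^ (suc x)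
    vy = q^ (suc y)
    vz = q^ (suc z)
    U  = trinomial (suc x) (suc z) y
    V  = trinomial (suc x) z (suc y)

  -- [i+y choose i][i+2y+1 choose y+1] = [i+y+1 choose i][i+2y+1 choose y],
  -- both being the trinomial coefficient of (i, y, y+1)
  gauss-exchange : ∀ i y → gauss i y * gauss (suc y) (i ℕ.+ y) ≈ gauss i (suc y) * gauss y (suc (i ℕ.+ y))
  gauss-exchange i y = begin
    gauss i y * gauss (suc y) (i ℕ.+ y)       ≈⟨ *-congˡ (gauss-sym (suc y) (i ℕ.+ y)) ⟩
    trinomial i y (suc y)                     ≈⟨ trinomial-sym i y (suc y) ⟩
    gauss i (suc y) * gauss (i ℕ.+ suc y) y
      ≈⟨ *-congˡ (trans (reflexive (P.cong (λ k → gauss k y) (ℕP.+-suc i y))) (gauss-sym (suc (i ℕ.+ y)) y)) ⟩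
    gauss i (suc y) * gauss y (suc (i ℕ.+ y)) ∎

module PochhammerCoefficients {c ℓ : Level} (R : CommutativeRing c ℓ) (q : CommutativeRing.Carrier R) where
  open CommutativeRing R hiding (zero)
  open Series R
  open import Relation.Binary.Reasoning.Setoid setoid
  open IntegerRingSolver R using (solve; _:=_; _:+_; _:*_; _:-_; :-_; :0; :1)
  open SumsAndPowers R
  open SeriesCalculus R
  open GaussianBinomials R q

  invPoch-zero : ∀ a n → invPoch q a n 0 ≈ 1#
  invPoch-zero a zero    = refl
  invPoch-zero a (suc n) = trans (mul-geom (a * q^ n) (invPoch q a n) 0) (invPoch-zero a n)

  invPoch-step : ∀ a n j → invPoch q a (suc n) (suc j) ≈ invPoch q a n (suc j) + (a * q^ n) * invPoch q a (suc n) j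
  invPoch-step a n j = trans (mul-geom _ _ (suc j)) (+-congˡ (*-congˡ (sym (mul-geom _ _ j))))

  invPoch-coeff : ∀ a n j → invPoch q a (suc n) j ≈ pow a j * gauss j n
  invPoch-coeff a n       zero    = trans (invPoch-zero a (suc n)) (sym (*-identityʳ _))
  invPoch-coeff a zero    (suc j) = begin
    invPoch q a 1 (suc j)                          ≈⟨ invPoch-step a zero j ⟩
    0# + (a * 1#) * invPoch q a 1 j                ≈⟨ +-congˡ (*-congˡ (invPoch-coeff a zero j)) ⟩
    0# + (a * 1#) * (pow a j * gauss j 0)          ≈⟨ +-congˡ (*-congˡ (*-congˡ (reflexive (gauss-x0 j)))) ⟩
    0# + (a * 1#) * (pow a j * 1#)
      ≈⟨ solve 2 (λ a x → :0 :+ (a :* :1) :* (x :* :1) := (a :* x) :* :1) refl a (pow a j) ⟩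
    (a * pow a j) * 1#                             ∎
  invPoch-coeff a (suc n) (suc j) = begin
    invPoch q a (suc (suc n)) (suc j)              ≈⟨ invPoch-step a (suc n) j ⟩
    invPoch q a (suc n) (suc j) + (a * q^ (suc n)) * invPoch q a (suc (suc n)) j
      ≈⟨ +-cong (invPoch-coeff a n (suc j)) (*-congˡ (invPoch-coeff a (suc n) j)) ⟩
    pow a (suc j) * gauss (suc j) n + (a * q^ (suc n)) * (pow a j * gauss j (suc n))
      ≈⟨ solve 5 (λ a x g u h → (a :* x) :* g :+ (a :* u) :* (x :* h) := (a :* x) :* (g :+ u :* h))
           refl a (pow a j) (gauss (suc j) n) (q^ (suc n)) (gauss j (suc n)) ⟩
    pow a (suc j) * gauss (suc j) (suc n)          ∎

  poch-zero : ∀ b m → poch q b m 0 ≈ 1#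
  poch-zero b zero    = refl
  poch-zero b (suc m) = trans (mul-lin (b * q^ m) (poch q b m) 0) (poch-zero b m)

  poch-step : ∀ b m i → poch q b (suc m) (suc i) ≈ poch q b m (suc i) - (b * q^ m) * poch q b m i
  poch-step b m i = mul-lin _ _ (suc i)

  poch-above : ∀ b m i → m < i → poch q b m i ≈ 0#
  poch-above b zero    (suc i) _         = refl
  poch-above b (suc m) (suc i) (s≤s m<i) = begin
    poch q b (suc m) (suc i)                       ≈⟨ poch-step b m i ⟩
    poch q b m (suc i) - (b * q^ m) * poch q b m i
      ≈⟨ +-cong (poch-above b m (suc i) (ℕP.m<n⇒m<1+n m<i)) (-‿cong (*-congˡ (poch-above b m i m<i))) ⟩
    0# - (b * q^ m) * 0#                           ≈⟨ solve 1 (λ x → :0 :- x :* :0 := :0) refl (b * q^ m) ⟩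
    0#                                             ∎

  -- (-b)^i q^{i(i-1)/2} = Π_{k<i} (-bq^k), the leading factor of [z^i](bz;q)_m
  leading : Carrier → ℕ → Carrier
  leading b zero    = 1#
  leading b (suc i) = (- (b * q^ i)) * leading b i

  poch-coeff : ∀ b m i → i ≤ m → poch q b m i ≈ leading b i * gauss i (m ∸ i)
  poch-coeff b zero    zero    _         = sym (*-identityʳ _)
  poch-coeff b (suc m) zero    _         = trans (poch-zero b (suc m)) (sym (*-identityʳ _))
  poch-coeff b (suc m) (suc i) (s≤s i≤m) with ℕP.m≤n⇒m<n∨m≡n i≤m
  ... | inj₂ P.refl = begin
    poch q b (suc i) (suc i)                        ≈⟨ poch-step b i i ⟩
    poch q b i (suc i) - (b * q^ i) * poch q b i i
      ≈⟨ +-cong (poch-above b i (suc i) (ℕP.n<1+n i)) (-‿cong (*-congˡ (poch-coeff b i i ℕP.≤-refl))) ⟩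
    0# - (b * q^ i) * (leading b i * gauss i (i ∸ i))
      ≈⟨ +-congˡ (-‿cong (*-congˡ (*-congˡ (reflexive (diagonal i))))) ⟩
    0# - (b * q^ i) * (leading b i * 1#)
      ≈⟨ solve 2 (λ x y → :0 :- x :* (y :* :1) := ((:- x) :* y) :* :1) refl (b * q^ i) (leading b i) ⟩
    leading b (suc i) * 1#                           ≈⟨ *-congˡ (reflexive (diagonal (suc i))) ⟨
    leading b (suc i) * gauss (suc i) (i ∸ i)        ∎
    where
    diagonal : ∀ j → gauss j (i ∸ i) ≡ 1#
    diagonal j = P.trans (P.cong (gauss j) (ℕP.n∸n≡0 i)) (gauss-x0 j)
  ... | inj₁ i<m = begin
    poch q b (suc m) (suc i)                         ≈⟨ poch-step b m i ⟩
    poch q b m (suc i) - (b * q^ m) * poch q b m i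
      ≈⟨ +-cong (poch-coeff b m (suc i) i<m) (-‿cong (*-cong (*-congˡ qm) (poch-coeff b m i i≤m))) ⟩
    leading b (suc i) * gauss (suc i) d - (b * (q^ i * q^ (suc d))) * (leading b i * gauss i (m ∸ i))
      ≈⟨ +-congˡ (-‿cong (*-congˡ (*-congˡ (reflexive (P.cong (gauss i) m-i))))) ⟩
    (- (b * q^ i)) * leading b i * gauss (suc i) d - (b * (q^ i * q^ (suc d))) * (leading b i * gauss i (suc d))
      ≈⟨ solve 6 (λ b u v l g h → (:- (b :* u)) :* l :* g :- (b :* (u :* v)) :* (l :* h)
                                := (:- (b :* u)) :* l :* (g :+ v :* h))
           refl b (q^ i) (q^ (suc d)) (leading b i) (gauss (suc i) d) (gauss i (suc d)) ⟩
    leading b (suc i) * gauss (suc i) (suc d)        ≡⟨ P.cong (λ k → leading b (suc i) * gauss (suc i) k) m-i ⟨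
    leading b (suc i) * gauss (suc i) (m ∸ i)        ∎
    where
    d = m ∸ suc i
    m-i : m ∸ i ≡ suc d
    m-i = ℕP.+-∸-assoc 1 i<m
    qm : q^ m ≈ q^ i * q^ (suc d)
    qm = trans (reflexive (P.cong q^ (P.trans (P.sym (ℕP.m+[n∸m]≡n i≤m)) (P.cong (i ℕ.+_) m-i)))) (pow-+ q i (suc d))

  -- [z^{N+1}] (bz;q)_N/(az;q)_{N+1} = a [z^N] (bz;q)_{N+1}/(az;q)_{N+2}: the two
  -- convolutions agree term by term, by gauss-exchange
  pochQuot-index-shift : ∀ a b N →
    coeff (suc N) (pochQuot q b N a (suc N)) ≈ a * coeff N (pochQuot q b (suc N) a (suc (suc N)))
  pochQuot-index-shift a b N = begin
    sumLt (suc N) (λ i → poch q b N i * invPoch q a (suc N) (suc N ∸ i))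
      + poch q b N (suc N) * invPoch q a (suc N) (N ∸ N)
      ≈⟨ +-cong (sum-cong (suc N) (λ i i<1+N → term i (ℕP.≤-pred i<1+N)))
                (trans (*-congʳ (poch-above b N (suc N) (ℕP.n<1+n N))) (zeroˡ _)) ⟩
    sumLt (suc N) (λ i → a * (poch q b (suc N) i * invPoch q a (suc (suc N)) (N ∸ i))) + 0#
      ≈⟨ trans (+-identityʳ _) (sym (sum-*ˡ (suc N) a _)) ⟩
    a * coeff N (pochQuot q b (suc N) a (suc (suc N))) ∎
    where
    term : ∀ i → i ≤ N → poch q b N i * invPoch q a (suc N) (suc N ∸ i)
                          ≈ a * (poch q b (suc N) i * invPoch q a (suc (suc N)) (N ∸ i))
    term i i≤N = begin
      poch q b N i * invPoch q a (suc N) (suc N ∸ i)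
        ≈⟨ *-cong (poch-coeff b N i i≤N)
                  (trans (reflexive (P.cong (invPoch q a (suc N)) (ℕP.+-∸-assoc 1 i≤N)))
                         (invPoch-coeff a N (suc y))) ⟩
      (leading b i * gauss i y) * (pow a (suc y) * gauss (suc y) N)
        ≡⟨ P.cong (λ k → (leading b i * gauss i y) * (pow a (suc y) * gauss (suc y) k)) N≡i+y ⟩
      (leading b i * gauss i y) * (pow a (suc y) * gauss (suc y) (i ℕ.+ y))
        ≈⟨ solve 5 (λ l g a x h → (l :* g) :* ((a :* x) :* h)
                                := (l :* (a :* x)) :* (g :* h)) refl (leading b i) (gauss i y) a (pow a y) _ ⟩
      (leading b i * (a * pow a y)) * (gauss i y * gauss (suc y) (i ℕ.+ y)) ≈⟨ *-congˡ (gauss-exchange i y) ⟩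
      (leading b i * (a * pow a y)) * (gauss i (suc y) * gauss y (suc (i ℕ.+ y)))
        ≈⟨ solve 5 (λ l g a x h → (l :* (a :* x)) :* (g :* h)
                                := a :* ((l :* g) :* (x :* h))) refl (leading b i) (gauss i (suc y)) a (pow a y) _ ⟩
      a * ((leading b i * gauss i (suc y)) * (pow a y * gauss y (suc (i ℕ.+ y))))
        ≡⟨ P.cong₂ (λ k l → a * ((leading b i * gauss i k) * (pow a y * gauss y (suc l))))
                   (ℕP.+-∸-assoc 1 i≤N) N≡i+y ⟨
      a * ((leading b i * gauss i (suc N ∸ i)) * (pow a y * gauss y (suc N)))
        ≈⟨ *-congˡ (*-cong (sym (poch-coeff b (suc N) i (ℕP.m≤n⇒m≤1+n i≤N))) (sym (invPoch-coeff a (suc N) y))) ⟩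
      a * (poch q b (suc N) i * invPoch q a (suc (suc N)) (N ∸ i)) ∎
      where
      y = N ∸ i
      N≡i+y : N ≡ i ℕ.+ y
      N≡i+y = P.sym (ℕP.m+[n∸m]≡n i≤N)

module Expansion {c ℓ : Level} (R : CommutativeRing c ℓ) (q : CommutativeRing.Carrier R)
                 (B : CommutativeRing.Carrier R → CommutativeRing.Carrier R → ℕ → ℕ → CommutativeRing.Carrier R)
                 (expansion : Series.IsBExpansion R q B) where
  open CommutativeRing R hiding (zero)
  open Series R
  open import Relation.Binary.Reasoning.Setoid setoid
  open IntegerRingSolver R using (solve; _:=_; _:+_; _:*_; _:-_)
  open SumsAndPowers R
  open SeriesCalculus R
  open PochhammerOperators R q using (pochQuot-dilate; pochQuot-product)
  open PochhammerCoefficients R q using (invPoch-zero; poch-zero; pochQuot-index-shift)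
  open import Data.Nat.Induction using (<-rec)

  term-from : ∀ a b k n m → k ≤ n → BTerm q (B a b) a b k n m ≈ B a b n k * shift n (pochQuot q a n b n) m
  term-from a b k n m k≤n with n <ᵇ k in n<ᵇk
  ... | true  = ⊥-elim (ℕP.<⇒≱ (ℕP.<ᵇ⇒< n k (P.subst T (P.sym n<ᵇk) tt)) k≤n)
  ... | false = refl

  term-below : ∀ a b k n m → n < k → BTerm q (B a b) a b k n m ≈ 0#
  term-below a b k n m n<k with n <ᵇ k in n<ᵇk
  ... | true  = refl
  ... | false = ⊥-elim (P.subst T n<ᵇk (ℕP.<⇒<ᵇ n<k))

  pochQuot-constant : ∀ y n x m → coeff 0 (pochQuot q y n x m) ≈ 1#
  pochQuot-constant y n x m =
    trans (+-congˡ (*-cong (poch-zero y n) (invPoch-zero x m))) (trans (+-identityˡ _) (*-identityˡ _))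

  earlier : Carrier → Carrier → ℕ → ℕ → Carrier
  earlier a b k n = sumLt n (λ j → BTerm q (B a b) a b k j n)

  -- [z^n] of the expansion: the n-th term contributes exactly B_{n,k}, so
  -- B_{n,k} = [z^n] z^k - earlier
  B-recursion : ∀ a b k n → k ≤ n → B a b n k ≈ shift k one n - earlier a b k n
  B-recursion a b k n k≤n = begin
    B a b n k
      ≈⟨ solve 2 (λ s x → x := (s :+ x) :- s) refl (earlier a b k n) (B a b n k) ⟩
    (earlier a b k n + B a b n k) - earlier a b k n ≈⟨ +-congʳ (+-congˡ (sym diagonal)) ⟩
    tsum (BTerm q (B a b) a b k) n - earlier a b k n ≈⟨ +-congʳ (expansion a b k n) ⟩
    shift k one n - earlier a b k n            ∎
    where
    diagonal : BTerm q (B a b) a b k n n ≈ B a b n k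
    diagonal = trans (term-from a b k n n k≤n) (trans (*-congˡ (trans
      (reflexive (P.trans (shift-above n _ n ℕP.≤-refl) (P.cong (pochQuot q a n b n) (ℕP.n∸n≡0 n))))
      (pochQuot-constant a n b n))) (*-identityʳ _))

  homogeneity : ∀ a b t k n → k ≤ n → B (a * t) (b * t) n k ≈ B a b n k * pow t (n ∸ k)
  homogeneity a b t k = <-rec (λ n → k ≤ n → B (a * t) (b * t) n k ≈ B a b n k * pow t (n ∸ k)) step
    where
    step : ∀ n → (∀ {j} → j < n → k ≤ j → B (a * t) (b * t) j k ≈ B a b j k * pow t (j ∸ k)) →
           k ≤ n → B (a * t) (b * t) n k ≈ B a b n k * pow t (n ∸ k)
    step n hyp k≤n = begin
      B (a * t) (b * t) n k                          ≈⟨ B-recursion (a * t) (b * t) k n k≤n ⟩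
      shift k one n - earlier (a * t) (b * t) k n
        ≈⟨ +-cong unit-coeff (-‿cong (trans (sum-cong n scaled-term) (sym (sum-*ʳ n τ _)))) ⟩
      shift k one n * τ - earlier a b k n * τ
        ≈⟨ solve 3 (λ d e τ → d :* τ :- e :* τ := (d :- e) :* τ) refl (shift k one n) (earlier a b k n) τ ⟩
      (shift k one n - earlier a b k n) * τ           ≈⟨ *-congʳ (B-recursion a b k n k≤n) ⟨
      B a b n k * τ                                   ∎
      where
      τ = pow t (n ∸ k)
      -- z^k has its only nonzero coefficient at n = k, where τ = 1
      unit-coeff : shift k one n ≈ shift k one n * τ
      unit-coeff = begin
        shift k one n                   ≡⟨ shift-above k one n k≤n ⟩
        one (n ∸ k)                     ≈⟨ dilate-one t (n ∸ k) ⟨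
        τ * one (n ∸ k)                 ≈⟨ *-comm _ _ ⟩
        one (n ∸ k) * τ                 ≡⟨ P.cong (_* τ) (shift-above k one n k≤n) ⟨
        shift k one n * τ               ∎
      scaled-term : ∀ j → j < n → BTerm q (B (a * t) (b * t)) (a * t) (b * t) k j n ≈ BTerm q (B a b) a b k j n * τ
      scaled-term j j<n with j ℕ.<? k
      ... | yes j<k = trans (term-below (a * t) (b * t) k j n j<k)
                            (trans (sym (zeroˡ τ)) (*-congʳ (sym (term-below a b k j n j<k))))
      ... | no j≮k  = begin
        BTerm q (B (a * t) (b * t)) (a * t) (b * t) k j n        ≈⟨ term-from (a * t) (b * t) k j n k≤j ⟩
        B (a * t) (b * t) j k * shift j (pochQuot q (a * t) j (b * t) j) n
          ≈⟨ *-cong (hyp j<n k≤j) (trans (reflexive (shift-above j _ n j≤n)) (pochQuot-dilate t a j b j (n ∸ j))) ⟩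
        (B a b j k * pow t (j ∸ k)) * (pow t (n ∸ j) * Q (n ∸ j))
          ≈⟨ solve 4 (λ x u v y → (x :* u) :* (v :* y)
                                := (x :* y) :* (u :* v))
               refl (B a b j k) (pow t (j ∸ k)) (pow t (n ∸ j)) (Q (n ∸ j)) ⟩
        (B a b j k * Q (n ∸ j)) * (pow t (j ∸ k) * pow t (n ∸ j))
          ≈⟨ *-cong (*-congˡ (reflexive (P.sym (shift-above j _ n j≤n)))) (sym (pow-+ t (j ∸ k) (n ∸ j))) ⟩
        (B a b j k * shift j Q n) * pow t ((j ∸ k) ℕ.+ (n ∸ j))
          ≡⟨ P.cong (λ e → (B a b j k * shift j Q n) * pow t e) exponents ⟩
        (B a b j k * shift j Q n) * τ                           ≈⟨ *-congʳ (term-from a b k j n k≤j) ⟨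
        BTerm q (B a b) a b k j n * τ                            ∎
        where
        k≤j = ℕP.≮⇒≥ j≮k
        j≤n = ℕP.<⇒≤ j<n
        Q = pochQuot q a j b j
        exponents : (j ∸ k) ℕ.+ (n ∸ j) ≡ n ∸ k
        exponents = P.trans (P.sym (ℕP.+-∸-comm (n ∸ j) k≤j)) (P.cong (_∸ k) (ℕP.m+[n∸m]≡n j≤n))

  product-coeff : ∀ a b m n → m ≤ n →
    mul (pochQuot q a m b m) (pochQuot q b n a (suc n)) (n ∸ m)
      ≈ pow q (m ℕ.* (n ∸ m)) * coeff (n ∸ m) (pochQuot q b (n ∸ m) a (suc (n ∸ m)))
  product-coeff a b m n m≤n = begin
    mul Q (pochQuot q b n a (suc n)) (n ∸ m)
      ≡⟨ P.cong (λ l → mul Q (pochQuot q b l a (suc l)) (n ∸ m)) (ℕP.m∸n+n≡m m≤n) ⟨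
    mul Q (pochQuot q b (k ℕ.+ m) a (suc k ℕ.+ m)) k ≈⟨ pochQuot-product a b m k (suc k) k ⟩
    pow (pow q m) k * coeff k (pochQuot q b k a (suc k)) ≈⟨ *-congʳ (pow-* q m k) ⟩
    pow q (m ℕ.* k) * coeff k (pochQuot q b k a (suc k)) ∎
    where
    k = n ∸ m
    Q = pochQuot q a m b m

  -- Multiply z = Σ_m B_{m,1} z^m (az;q)_m/(bz;q)_m by (bz;q)_n/(az;q)_{n+1} and
  -- compare [z^n]; the left side is rewritten by pochQuot-index-shift.
  convolution : ∀ a b N → let n = suc N in
    coeff n (pochQuot q b N a n)
      ≈ a * sumLt n (λ i → B a b (n ∸ i) 1 * pow q ((n ∸ i) ℕ.* i) * coeff i (pochQuot q b i a (suc i)))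
  convolution a b N = begin
    coeff n (pochQuot q b N a n)          ≈⟨ pochQuot-index-shift a b N ⟩
    a * G N                               ≈⟨ *-congˡ (begin
      G N                                   ≈⟨ one-mul G N ⟨
      mul one G N                           ≈⟨ mul-shift 1 one G n (s≤s z≤n) ⟨
      mul (shift 1 one) G n                 ≈⟨ mul-cong {g = G} (λ j → sym (expansion a b 1 j)) ≋-refl n ⟩
      mul (tsum s) G n                      ≈⟨ mul-tsum s G n order ⟩
      sumLt (suc n) (λ m → mul (s m) G n)   ≈⟨ sum-first n _ ⟩
      mul (s 0) G n + sumLt n (λ m → mul (s (suc m)) G n)
        ≈⟨ +-cong (sum-zero (suc n) _ (λ j _ → zeroˡ _)) (sum-cong n later-term) ⟩
      0# + sumLt n term                     ≈⟨ +-identityˡ _ ⟩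
      sumLt n term                          ≈⟨ sum-reverse n term ⟩
      sumLt n (λ i → term (n ∸ suc i))      ≈⟨ sum-cong n reindex ⟩
      sumLt n summand                       ∎) ⟩
    a * sumLt n summand                   ∎
    where
    n = suc N
    G = pochQuot q b n a (suc n)
    s = BTerm q (B a b) a b 1
    summand : ℕ → Carrier
    summand i = B a b (n ∸ i) 1 * pow q ((n ∸ i) ℕ.* i) * coeff i (pochQuot q b i a (suc i))
    term : ℕ → Carrier
    term m = B a b (suc m) 1 * (pow q (suc m ℕ.* k) * coeff k (pochQuot q b k a (suc k)))
      where k = n ∸ suc m
    order : ∀ m j → j < m → s m j ≈ 0#
    order (suc m) j j<m = trans (*-congˡ (reflexive (shift-below (suc m) _ j j<m))) (zeroʳ _)
    later-term : ∀ m → m < n → mul (s (suc m)) G n ≈ term m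
    later-term m m<n = begin
      sumLt (suc n) (λ j → (B a b (suc m) 1 * shift (suc m) Q j) * G (n ∸ j))
        ≈⟨ sum-cong (suc n) (λ j _ → *-assoc _ _ _) ⟩
      sumLt (suc n) (λ j → B a b (suc m) 1 * (shift (suc m) Q j * G (n ∸ j))) ≈⟨ sum-*ˡ (suc n) _ _ ⟨
      B a b (suc m) 1 * mul (shift (suc m) Q) G n ≈⟨ *-congˡ (mul-shift (suc m) Q G n m<n) ⟩
      B a b (suc m) 1 * mul Q G (n ∸ suc m)       ≈⟨ *-congˡ (product-coeff a b (suc m) n m<n) ⟩
      term m                                      ∎
      where Q = pochQuot q a (suc m) b (suc m)
    reindex : ∀ i → i < n → term (n ∸ suc i) ≈ summand i
    reindex i i<n = trans
      (reflexive (P.cong₂ (λ k l → B a b k 1 * (pow q (k ℕ.* l) * coeff l (pochQuot q b l a (suc l))))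
                          (P.sym (ℕP.+-∸-assoc 1 i<n)) (ℕP.m∸[m∸n]≡n (ℕP.≤-pred i<n))))
      (sym (*-assoc _ _ _))


mainTheorem6 : ∀ {c ℓ : Level} (R : CommutativeRing c ℓ) →
    let open CommutativeRing R in let open Series R in
    (q : Carrier) (B : Carrier → Carrier → ℕ → ℕ → Carrier) →
    IsBExpansion q B →
    (a b : Carrier) (n : ℕ) → 1 ≤ n →
    ((k : ℕ) → k ≤ n → (t : Carrier) →
       B (a * t) (b * t) n k ≈ B a b n k * pow t (n ∸ k))
    ×
    (coeff n (pochQuot q b (n ∸ 1) a n)
       ≈ a * sumLt n (λ i → B a b (n ∸ i) 1 * pow q ((n ∸ i) ℕ.* i)
                             * coeff i (pochQuot q b i a (ℕ.suc i))))
mainTheorem6 R q B expansion a b (suc N) (s≤s z≤n) =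
  (λ k k≤n t → homogeneity a b t k (suc N) k≤n) , convolution a b N
  where open Expansion R q B expansion
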